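{- Let $\alpha\in\mathbb N=\{1,2,\dots\}$ and $n\ge0$. The matrix $$\left(\frac{1}{\alpha\binom{\alpha+i+j}{\alpha}}\right)_{i,j=0}^n$$ is invertible and its inverse has integer entries. -}

module Defs where

open import Data.Nat.Base as ℕ using (ℕ; zero; suc; _+_; NonZero)
open import Data.Nat.Properties using (m*n≢0)
open import Data.Nat.Combinatorics using (_C_; nCk+nC[k+1]≡[n+1]C[k+1])
open import Data.Integer.Base using (ℤ; +_)
open import Data.Fin.Base using (Fin; zero; suc; toℕ)
open import Data.Rational.Base using (ℚ; _/_; 0ℚ; 1ℚ) renaming (_+_ to _+ℚ_; _*_ to _*ℚ_)
open import Relation.Binary.PropositionalEquality using (_≡_; subst)


infixl 7 _·_
infix 4 _≐_

Matrix : Set → ℕ → Set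
Matrix A n = Fin n → Fin n → A

Σℚ : (n : ℕ) → (Fin n → ℚ) → ℚ
Σℚ zero    f = 0ℚ
Σℚ (suc n) f = f zero +ℚ Σℚ n (λ i → f (suc i))

_·_ : {n : ℕ} → Matrix ℚ n → Matrix ℚ n → Matrix ℚ n
(A · B) i j = Σℚ _ (λ k → A i k *ℚ B k j)

I : (n : ℕ) → Matrix ℚ n
I (suc n) zero    zero    = 1ℚ
I (suc n) zero    (suc j) = 0ℚ
I (suc n) (suc i) zero    = 0ℚ
I (suc n) (suc i) (suc j) = I n i j

_≐_ : {A : Set} {n : ℕ} → Matrix A n → Matrix A n → Set
M ≐ N = ∀ i j → M i j ≡ N i j

toℚ : {n : ℕ} → Matrix ℤ n → Matrix ℚ n
toℚ B i j = B i j / 1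

private
  nz-+ : ∀ a b → NonZero a → NonZero (a + b)
  nz-+ (suc a) b _ = _

binom-nz : ∀ k m → NonZero ((k + m) C k)
binom-nz zero    m       = _
binom-nz (suc k) zero    =
  subst NonZero (nCk+nC[k+1]≡[n+1]C[k+1] (k + 0) k) (nz-+ _ _ (binom-nz k zero))
binom-nz (suc k) (suc m) =
  subst NonZero (nCk+nC[k+1]≡[n+1]C[k+1] (k + suc m) k) (nz-+ _ _ (binom-nz k (suc m)))

-- The paper's matrix: entries 1 / (α · binom(α+i+j, α)), i, j = 0..n.
-- (Size n+1, indices Fin (suc n) ↔ 0..n.)
hilbertLike : (α : ℕ) → .{{NonZero α}} → (n : ℕ) → Matrix ℚ (suc n)
hilbertLike α {{α≢0}} n i j =
  (+ 1 / (α ℕ.* ((α + (toℕ i + toℕ j)) C α))) {{m*n≢0 α _ {{α≢0}} {{binom-nz α (toℕ i + toℕ j)}}}}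

{-# OPTIONS --safe #-}
module Submission where

-- Write α = a + 1, so that the entry with i + j = s is c s = a! s! / (s + α)!, and let
-- A m k = (-1)^k C(m,k) C(k+m+a,k) and w m = 2m + α.  Multiplied by (m+a)!, the k-th term
-- of ∑_k c(i+k) A m k becomes a! (-1)^k C(m,k) times (k+1)⋯(k+i) · (k+i+α+1)⋯(k+m+a) when
-- i < m: a polynomial in k of degree m - 1, which the alternating binomial sum of order m
-- annihilates.  When i = m it becomes a! (-1)^k C(m,k) (k+1)⋯(k+m) / (k+m+α); dividing by
-- k + m + α leaves the remainder (-1)^m (a+1)⋯(a+m), and the beta-type evaluation
-- ∑_k (-1)^k C(m,k) / (k+m+α) = m! (m+a)! / (2m+α)! gives w m · A m m · ∑_k c(m+k) A m k = 1.
-- Hence the rows A m of a triangular integer matrix are orthogonal to the earlier rows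
-- of the matrix H, and bordering H one row and column at a time shows that the integer
-- matrix ∑_m w m A m A mᵀ is its inverse.

open import Defs
open import Algebra.Bundles using (CommutativeRing)
open import Data.Fin.Base as Fin using (Fin; toℕ)
open import Data.Fin.Properties using (toℕ<n; toℕ-inject₁; toℕ-fromℕ)
open import Data.Integer.Base as ℤ using (ℤ; +_; -1ℤ)
import Data.Integer.Properties as ℤ
open import Data.Nat.Base as ℕ using (ℕ; zero; suc; NonZero; _!; _∸_; _<_; _≤_; z≤n; s≤s)
open import Data.Nat.Combinatorics
  using (_C_; nCk≡n!/k![n-k]!; k![n∸k]!∣n!; nCk+nC[k+1]≡[n+1]C[k+1]; nCk≡nC[n∸k]; nCn≡1; k>n⇒nCk≡0)
open import Data.Nat.DivMod using (m/n*n≡m)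
import Data.Nat.Properties as ℕ
open import Data.Product using (Σ; _×_; _,_)
open import Data.Rational.Base using (ℚ; 0ℚ; 1ℚ; _+_; _*_; -_; _-_; _/_; fromℚᵘ)
import Data.Rational.Properties as ℚ
import Data.Rational.Unnormalised.Base as ℚᵘ
import Data.Rational.Unnormalised.Properties as ℚᵘ
open import Data.Sum using (_⊎_; inj₁; inj₂)
open import Function.Base using (_∘_)
open import Level using (0ℓ)
open import Relation.Binary.PropositionalEquality
open import Relation.Nullary.Decidable.Core using (dec⇒maybe)
open import Relation.Nullary.Negation using (contradiction)
open import Algebra.Properties.Semiring.Sum (CommutativeRing.semiring ℚ.+-*-commutativeRing)
  using (sum; sum-cong-≗; sum-replicate-zero; sum-init-last; ∑-distrib-+; ∑-comm; *-distribˡ-sum; *-distribʳ-sum)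
import Tactic.RingSolver as Solver
open import Tactic.RingSolver.Core.AlmostCommutativeRing using (AlmostCommutativeRing; fromCommutativeRing)

open ≡-Reasoning

ℚ-ring : AlmostCommutativeRing 0ℓ 0ℓ
ℚ-ring = fromCommutativeRing ℚ.+-*-commutativeRing (λ x → dec⇒maybe (0ℚ ℚ.≟ x))

fromℚᵘ-+ : ∀ p q → fromℚᵘ (p ℚᵘ.+ q) ≡ fromℚᵘ p + fromℚᵘ q
fromℚᵘ-+ p q = ℚ.toℚᵘ-injective (ℚᵘ.≃-trans (ℚ.toℚᵘ-fromℚᵘ (p ℚᵘ.+ q))
  (ℚᵘ.≃-sym (ℚᵘ.≃-trans (ℚ.toℚᵘ-homo-+ (fromℚᵘ p) (fromℚᵘ q))
                        (ℚᵘ.+-cong (ℚ.toℚᵘ-fromℚᵘ p) (ℚ.toℚᵘ-fromℚᵘ q)))))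

fromℚᵘ-* : ∀ p q → fromℚᵘ (p ℚᵘ.* q) ≡ fromℚᵘ p * fromℚᵘ q
fromℚᵘ-* p q = ℚ.toℚᵘ-injective (ℚᵘ.≃-trans (ℚ.toℚᵘ-fromℚᵘ (p ℚᵘ.* q))
  (ℚᵘ.≃-sym (ℚᵘ.≃-trans (ℚ.toℚᵘ-homo-* (fromℚᵘ p) (fromℚᵘ q))
                        (ℚᵘ.*-cong (ℚ.toℚᵘ-fromℚᵘ p) (ℚ.toℚᵘ-fromℚᵘ q)))))

-- Opaque, so that unification never unfolds the gcd normalisation inside _/_.
opaque
  fromℤ : ℤ → ℚ
  fromℤ z = z / 1

  inv : (n : ℕ) → .{{NonZero n}} → ℚ
  inv n = + 1 / n

  fromℤ≡/1 : ∀ z → fromℤ z ≡ z / 1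
  fromℤ≡/1 z = refl

  inv≡1/ : ∀ n .{{_ : NonZero n}} → inv n ≡ + 1 / n
  inv≡1/ n = refl

  fromℤ-0 : fromℤ (+ 0) ≡ 0ℚ
  fromℤ-0 = refl

  fromℤ-1 : fromℤ (+ 1) ≡ 1ℚ
  fromℤ-1 = refl

  fromℤ-[-1] : fromℤ -1ℤ ≡ - 1ℚ
  fromℤ-[-1] = refl

  fromℤ-+ : ∀ x y → fromℤ (x ℤ.+ y) ≡ fromℤ x + fromℤ y
  fromℤ-+ x y =
    trans (ℚ.fromℚᵘ-cong {ℚᵘ.mkℚᵘ (x ℤ.+ y) 0} {ℚᵘ.mkℚᵘ x 0 ℚᵘ.+ ℚᵘ.mkℚᵘ y 0} (ℚᵘ.*≡* x+y≡))
          (fromℚᵘ-+ (ℚᵘ.mkℚᵘ x 0) (ℚᵘ.mkℚᵘ y 0))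
    where x+y≡ : (x ℤ.+ y) ℤ.* + 1 ≡ (x ℤ.* + 1 ℤ.+ y ℤ.* + 1) ℤ.* + 1
          x+y≡ = cong (ℤ._* + 1) (sym (cong₂ ℤ._+_ (ℤ.*-identityʳ x) (ℤ.*-identityʳ y)))

  fromℤ-* : ∀ x y → fromℤ (x ℤ.* y) ≡ fromℤ x * fromℤ y
  fromℤ-* x y =
    trans (ℚ.fromℚᵘ-cong {ℚᵘ.mkℚᵘ (x ℤ.* y) 0} {ℚᵘ.mkℚᵘ x 0 ℚᵘ.* ℚᵘ.mkℚᵘ y 0} (ℚᵘ.*≡* refl))
          (fromℚᵘ-* (ℚᵘ.mkℚᵘ x 0) (ℚᵘ.mkℚᵘ y 0))

  fromℤ*inv≡1 : ∀ n .{{_ : NonZero n}} → fromℤ (+ n) * inv n ≡ 1ℚ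
  fromℤ*inv≡1 (suc n) =
    trans (sym (fromℚᵘ-* (ℚᵘ.mkℚᵘ (+ suc n) 0) (ℚᵘ.mkℚᵘ (+ 1) n)))
          (ℚ.fromℚᵘ-cong {ℚᵘ.mkℚᵘ (+ suc n) 0 ℚᵘ.* ℚᵘ.mkℚᵘ (+ 1) n} {ℚᵘ.mkℚᵘ (+ 1) 0} (ℚᵘ.*≡* n*1≡1*n))
    where n*1≡1*n : (+ suc n ℤ.* + 1) ℤ.* + 1 ≡ + 1 ℤ.* + suc (n ℕ.+ 0)
          n*1≡1*n = trans (ℤ.*-identityʳ _) (trans (ℤ.*-identityʳ _)
                      (trans (cong (λ x → + suc x) (sym (ℕ.+-identityʳ n))) (sym (ℤ.*-identityˡ _))))

fromℕ : ℕ → ℚ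
fromℕ n = fromℤ (+ n)

fromℕ-+ : ∀ m n → fromℕ (m ℕ.+ n) ≡ fromℕ m + fromℕ n
fromℕ-+ m n = trans (cong fromℤ (ℤ.pos-+ m n)) (fromℤ-+ (+ m) (+ n))

fromℕ-* : ∀ m n → fromℕ (m ℕ.* n) ≡ fromℕ m * fromℕ n
fromℕ-* m n = trans (cong fromℤ (ℤ.pos-* m n)) (fromℤ-* (+ m) (+ n))

fromℕ-suc : ∀ n → fromℕ (suc n) ≡ 1ℚ + fromℕ n
fromℕ-suc n = trans (fromℕ-+ 1 n) (cong (_+ fromℕ n) fromℤ-1)

fromℕ*inv≡1 : ∀ n .{{_ : NonZero n}} → fromℕ n * inv n ≡ 1ℚ
fromℕ*inv≡1 = fromℤ*inv≡1

*-cancelˡ-invertible : ∀ {u v x y} → u * v ≡ 1ℚ → u * x ≡ u * y → x ≡ y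
*-cancelˡ-invertible {u} {v} {x} {y} uv≡1 ux≡uy = begin
  x               ≡⟨ ℚ.*-identityˡ x ⟨
  1ℚ * x          ≡⟨ cong (_* x) uv≡1 ⟨
  (u * v) * x     ≡⟨ reassoc u v x ⟩
  v * (u * x)     ≡⟨ cong (v *_) ux≡uy ⟩
  v * (u * y)     ≡⟨ reassoc u v y ⟨
  (u * v) * y     ≡⟨ cong (_* y) uv≡1 ⟩
  1ℚ * y          ≡⟨ ℚ.*-identityˡ y ⟩
  y               ∎
  where reassoc : ∀ u v z → (u * v) * z ≡ v * (u * z)
        reassoc = Solver.solve-∀ ℚ-ring

fromℕ-*-cancelˡ : ∀ n .{{_ : NonZero n}} {x y} → fromℕ n * x ≡ fromℕ n * y → x ≡ y
fromℕ-*-cancelˡ n = *-cancelˡ-invertible {fromℕ n} {inv n} (fromℕ*inv≡1 n)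

*fromℕ≡⇒≡*inv : ∀ n .{{_ : NonZero n}} {x y} → x * fromℕ n ≡ y → x ≡ y * inv n
*fromℕ≡⇒≡*inv n {x} {y} xn≡y = begin
  x                          ≡⟨ ℚ.*-identityʳ x ⟨
  x * 1ℚ                     ≡⟨ cong (x *_) (fromℕ*inv≡1 n) ⟨
  x * (fromℕ n * inv n)      ≡⟨ ℚ.*-assoc x (fromℕ n) (inv n) ⟨
  x * fromℕ n * inv n        ≡⟨ cong (_* inv n) xn≡y ⟩
  y * inv n                  ∎

inv-cong : ∀ {m n} .{{_ : NonZero m}} .{{_ : NonZero n}} → m ≡ n → inv m ≡ inv n
inv-cong refl = refl

-- Opaque, so that the summand of ∑ n f can be recovered by unification.
opaque
  ∑ : (n : ℕ) → (ℕ → ℚ) → ℚ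
  ∑ n f = sum {n} (λ i → f (toℕ i))

  Σℚ≡∑ : ∀ n (F : Fin n → ℚ) (f : ℕ → ℚ) → (∀ i → F i ≡ f (toℕ i)) → Σℚ n F ≡ ∑ n f
  Σℚ≡∑ zero    F f F≗f = refl
  Σℚ≡∑ (suc n) F f F≗f =
    cong₂ _+_ (F≗f Fin.zero) (Σℚ≡∑ n (F ∘ Fin.suc) (f ∘ suc) (F≗f ∘ Fin.suc))

  ∑-suc : ∀ n (f : ℕ → ℚ) → ∑ (suc n) f ≡ f 0 + ∑ n (f ∘ suc)
  ∑-suc n f = refl

  ∑-one : ∀ (f : ℕ → ℚ) → ∑ 1 f ≡ f 0
  ∑-one f = ℚ.+-identityʳ (f 0)

  ∑-last : ∀ n (f : ℕ → ℚ) → ∑ (suc n) f ≡ ∑ n f + f n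
  ∑-last n f = trans (sum-init-last {n} (f ∘ toℕ))
    (cong₂ _+_ (sum-cong-≗ {n} (cong f ∘ toℕ-inject₁)) (cong f (toℕ-fromℕ n)))

  ∑-cong : ∀ {n} {f g : ℕ → ℚ} → (∀ k → f k ≡ g k) → ∑ n f ≡ ∑ n g
  ∑-cong {n} f≗g = sum-cong-≗ {n} (f≗g ∘ toℕ)

  ∑-cong< : ∀ {n} {f g : ℕ → ℚ} → (∀ {k} → k < n → f k ≡ g k) → ∑ n f ≡ ∑ n g
  ∑-cong< {n} f≗g = sum-cong-≗ {n} (f≗g ∘ toℕ<n)

  ∑-zero : ∀ n → ∑ n (λ _ → 0ℚ) ≡ 0ℚ
  ∑-zero n = sum-replicate-zero n

  ∑-+ : ∀ {n} (f g : ℕ → ℚ) → ∑ n (λ k → f k + g k) ≡ ∑ n f + ∑ n g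
  ∑-+ {n} f g = ∑-distrib-+ {n} (f ∘ toℕ) (g ∘ toℕ)

  ∑-*ˡ : ∀ {n} x (f : ℕ → ℚ) → ∑ n (λ k → x * f k) ≡ x * ∑ n f
  ∑-*ˡ {n} x f = sym (*-distribˡ-sum {n} x (f ∘ toℕ))

  ∑-*ʳ : ∀ {n} x (f : ℕ → ℚ) → ∑ n (λ k → f k * x) ≡ ∑ n f * x
  ∑-*ʳ {n} x f = sym (*-distribʳ-sum {n} x (f ∘ toℕ))

  ∑-swap : ∀ m n (F : ℕ → ℕ → ℚ) → ∑ m (λ k → ∑ n (F k)) ≡ ∑ n (λ l → ∑ m (λ k → F k l))
  ∑-swap m n F = ∑-comm {m} {n} (λ i j → F (toℕ i) (toℕ j))

∑-neg : ∀ {n} (f : ℕ → ℚ) → ∑ n (λ k → - f k) ≡ - ∑ n f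
∑-neg {n} f = begin
  ∑ n (λ k → - f k)             ≡⟨ ∑-cong (λ k → neg≡-1* (f k)) ⟩
  ∑ n (λ k → (- 1ℚ) * f k)      ≡⟨ ∑-*ˡ (- 1ℚ) f ⟩
  (- 1ℚ) * ∑ n f                ≡⟨ neg≡-1* (∑ n f) ⟨
  - ∑ n f                       ∎
  where neg≡-1* : ∀ x → - x ≡ (- 1ℚ) * x
        neg≡-1* = Solver.solve-∀ ℚ-ring

∑-- : ∀ {n} (f g : ℕ → ℚ) → ∑ n (λ k → f k - g k) ≡ ∑ n f - ∑ n g
∑-- {n} f g = trans (∑-+ f (λ k → - g k)) (cong (_+_ (∑ n f)) (∑-neg g))

-- Finite differences and polynomial degree

Δ : (ℕ → ℚ) → ℕ → ℚ
Δ f k = f (suc k) - f k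

DegreeBelow : ℕ → (ℕ → ℚ) → Set
DegreeBelow zero    f = ∀ k → f k ≡ 0ℚ
DegreeBelow (suc d) f = DegreeBelow d (Δ f)

DegreeBelow-cong : ∀ d {f g : ℕ → ℚ} → (∀ k → f k ≡ g k) → DegreeBelow d f → DegreeBelow d g
DegreeBelow-cong zero    f≗g f<d k = trans (sym (f≗g k)) (f<d k)
DegreeBelow-cong (suc d) f≗g f<d   = DegreeBelow-cong d (λ k → cong₂ _-_ (f≗g (suc k)) (f≗g k)) f<d

DegreeBelow-+ : ∀ d {f g} → DegreeBelow d f → DegreeBelow d g → DegreeBelow d (λ k → f k + g k)
DegreeBelow-+ zero    f<d g<d k = cong₂ _+_ (f<d k) (g<d k)
DegreeBelow-+ (suc d) {f} {g} f<d g<d =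
  DegreeBelow-cong d (λ k → Δ-+ (f (suc k)) (g (suc k)) (f k) (g k)) (DegreeBelow-+ d f<d g<d)
  where Δ-+ : ∀ f₁ g₁ f₀ g₀ → (f₁ - f₀) + (g₁ - g₀) ≡ (f₁ + g₁) - (f₀ + g₀)
        Δ-+ = Solver.solve-∀ ℚ-ring

DegreeBelow-suc : ∀ d {f} → DegreeBelow d f → DegreeBelow (suc d) f
DegreeBelow-suc zero    f≡0 k = cong₂ _-_ (f≡0 (suc k)) (f≡0 k)
DegreeBelow-suc (suc d) f<d   = DegreeBelow-suc d f<d

DegreeBelow-≤ : ∀ {d e f} → d ≤ e → DegreeBelow d f → DegreeBelow e f
DegreeBelow-≤ {zero} {zero}  z≤n f≡0     = f≡0
DegreeBelow-≤ {zero} {suc e} z≤n f≡0     = DegreeBelow-≤ {zero} {e} z≤n (DegreeBelow-suc zero f≡0)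
DegreeBelow-≤ (s≤s d≤e)          f<d     = DegreeBelow-≤ d≤e f<d

DegreeBelow-zero : ∀ d {f} → (∀ k → f k ≡ 0ℚ) → DegreeBelow d f
DegreeBelow-zero d {f} = DegreeBelow-≤ {zero} {d} {f} z≤n

DegreeBelow-shift : ∀ d {f} → DegreeBelow d f → DegreeBelow d (f ∘ suc)
DegreeBelow-shift zero    f≡0 k = f≡0 (suc k)
DegreeBelow-shift (suc d) f<d   = DegreeBelow-shift d f<d

DegreeBelow-* : ∀ a b {f g} → DegreeBelow (suc a) f → DegreeBelow (suc b) g →
                DegreeBelow (suc (a ℕ.+ b)) (λ k → f k * g k)
DegreeBelow-* a b {f} {g} f<a g<b =
  DegreeBelow-cong (a ℕ.+ b) (λ k → leibniz (f (suc k)) (f k) (g (suc k)) (g k))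
    (DegreeBelow-+ (a ℕ.+ b) {λ k → Δ f k * g (suc k)} {λ k → f k * Δ g k} (Δf·g a f<a) (f·Δg g<b))
  where
  leibniz : ∀ f₁ f₀ g₁ g₀ → (f₁ - f₀) * g₁ + f₀ * (g₁ - g₀) ≡ f₁ * g₁ - f₀ * g₀
  leibniz = Solver.solve-∀ ℚ-ring
  Δf·g : ∀ a → DegreeBelow (suc a) f → DegreeBelow (a ℕ.+ b) (λ k → Δ f k * g (suc k))
  Δf·g zero    Δf≡0 = DegreeBelow-zero b (λ k → trans (cong (_* g (suc k)) (Δf≡0 k)) (ℚ.*-zeroˡ (g (suc k))))
  Δf·g (suc a) Δf<a = DegreeBelow-* a b {Δ f} {g ∘ suc} Δf<a (DegreeBelow-shift (suc b) {g} g<b)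
  f·Δg : ∀ {b} → DegreeBelow (suc b) g → DegreeBelow (a ℕ.+ b) (λ k → f k * Δ g k)
  f·Δg {zero}  Δg≡0 = DegreeBelow-zero (a ℕ.+ 0) (λ k → trans (cong (f k *_) (Δg≡0 k)) (ℚ.*-zeroʳ (f k)))
  f·Δg {suc b} Δg<b = subst (λ d → DegreeBelow d (λ k → f k * Δ g k)) (sym (ℕ.+-suc a b))
                        (DegreeBelow-* a b {f} {Δ g} f<a Δg<b)

DegreeBelow-const : ∀ x → DegreeBelow 1 (λ _ → x)
DegreeBelow-const x k = ℚ.+-inverseʳ x

DegreeBelow-affine : ∀ y → DegreeBelow 2 (λ k → y + fromℕ k)
DegreeBelow-affine y = DegreeBelow-cong 1 (λ k → sym (Δ-affine k)) (DegreeBelow-const 1ℚ)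
  where
  Δ-affine : ∀ k → (y + fromℕ (suc k)) - (y + fromℕ k) ≡ 1ℚ
  Δ-affine k = trans (cong (λ z → (y + z) - (y + fromℕ k)) (fromℕ-suc k)) (cancel y (fromℕ k))
    where cancel : ∀ y z → (y + (1ℚ + z)) - (y + z) ≡ 1ℚ
          cancel = Solver.solve-∀ ℚ-ring

-- Rising factorials and binomial coefficients

rising : ℚ → ℕ → ℚ
rising x zero    = 1ℚ
rising x (suc d) = x * rising (x + 1ℚ) d

DegreeBelow-rising : ∀ d {g} → DegreeBelow 2 g → DegreeBelow (suc d) (λ k → rising (g k) d)
DegreeBelow-rising zero    g<2 = DegreeBelow-const 1ℚ
DegreeBelow-rising (suc d) {g} g<2 = DegreeBelow-* 1 d {g} {λ k → rising (g k + 1ℚ) d} g<2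
  (DegreeBelow-rising d (DegreeBelow-+ 2 {g} g<2 (DegreeBelow-suc 1 {λ _ → 1ℚ} (DegreeBelow-const 1ℚ))))

rising-+ : ∀ x d e → rising x (d ℕ.+ e) ≡ rising x d * rising (x + fromℕ d) e
rising-+ x zero    e = sym (trans (ℚ.*-identityˡ _) (cong (λ y → rising y e) x+0≡x))
  where x+0≡x : x + fromℕ 0 ≡ x
        x+0≡x = trans (cong (_+_ x) fromℤ-0) (ℚ.+-identityʳ x)
rising-+ x (suc d) e = begin
  x * rising (x + 1ℚ) (d ℕ.+ e)                            ≡⟨ cong (x *_) (rising-+ (x + 1ℚ) d e) ⟩
  x * (rising (x + 1ℚ) d * rising (x + 1ℚ + fromℕ d) e)    ≡⟨ ℚ.*-assoc x _ _ ⟨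
  x * rising (x + 1ℚ) d * rising (x + 1ℚ + fromℕ d) e      ≡⟨ cong (λ y → x * rising (x + 1ℚ) d * rising y e) shift ⟩
  x * rising (x + 1ℚ) d * rising (x + fromℕ (suc d)) e     ∎
  where shift : x + 1ℚ + fromℕ d ≡ x + fromℕ (suc d)
        shift = trans (ℚ.+-assoc x 1ℚ (fromℕ d)) (cong (_+_ x) (sym (fromℕ-suc d)))

rising-suc : ∀ x d → rising x (suc d) ≡ rising x d * (x + fromℕ d)
rising-suc x d = begin
  rising x (suc d)                   ≡⟨ cong (rising x) (ℕ.+-comm 1 d) ⟩
  rising x (d ℕ.+ 1)                 ≡⟨ rising-+ x d 1 ⟩
  rising x d * ((x + fromℕ d) * 1ℚ)  ≡⟨ cong (rising x d *_) (ℚ.*-identityʳ _) ⟩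
  rising x d * (x + fromℕ d)         ∎

fromℕ-! : ∀ n → fromℕ (n !) ≡ rising 1ℚ n
fromℕ-! zero    = fromℤ-1
fromℕ-! (suc n) = begin
  fromℕ (suc n ℕ.* n !)             ≡⟨ fromℕ-* (suc n) (n !) ⟩
  fromℕ (suc n) * fromℕ (n !)       ≡⟨ cong₂ _*_ (fromℕ-suc n) (fromℕ-! n) ⟩
  (1ℚ + fromℕ n) * rising 1ℚ n      ≡⟨ ℚ.*-comm (1ℚ + fromℕ n) (rising 1ℚ n) ⟩
  rising 1ℚ n * (1ℚ + fromℕ n)      ≡⟨ rising-suc 1ℚ n ⟨
  rising 1ℚ (suc n)                 ∎

fromℕ-!-+ : ∀ x d → fromℕ ((x ℕ.+ d) !) ≡ fromℕ (x !) * rising (1ℚ + fromℕ x) d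
fromℕ-!-+ x d = begin
  fromℕ ((x ℕ.+ d) !)                      ≡⟨ fromℕ-! (x ℕ.+ d) ⟩
  rising 1ℚ (x ℕ.+ d)                      ≡⟨ rising-+ 1ℚ x d ⟩
  rising 1ℚ x * rising (1ℚ + fromℕ x) d    ≡⟨ cong (_* rising (1ℚ + fromℕ x) d) (fromℕ-! x) ⟨
  fromℕ (x !) * rising (1ℚ + fromℕ x) d    ∎

sign : ℕ → ℚ
sign k = fromℤ (-1ℤ ℤ.^ k)

sign-zero : sign 0 ≡ 1ℚ
sign-zero = fromℤ-1

sign-suc : ∀ k → sign (suc k) ≡ - sign k
sign-suc k = trans (fromℤ-* -1ℤ (-1ℤ ℤ.^ k)) (trans (cong (_* sign k) fromℤ-[-1]) (-1*x≡-x (sign k)))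
  where -1*x≡-x : ∀ x → (- 1ℚ) * x ≡ - x
        -1*x≡-x = Solver.solve-∀ ℚ-ring

sign-square : ∀ k → sign k * sign k ≡ 1ℚ
sign-square zero    = cong₂ _*_ sign-zero sign-zero
sign-square (suc k) = begin
  sign (suc k) * sign (suc k)     ≡⟨ cong₂ _*_ (sign-suc k) (sign-suc k) ⟩
  (- sign k) * (- sign k)         ≡⟨ neg*neg (sign k) ⟩
  sign k * sign k                 ≡⟨ sign-square k ⟩
  1ℚ                              ∎
  where neg*neg : ∀ x → (- x) * (- x) ≡ x * x
        neg*neg = Solver.solve-∀ ℚ-ring

rising-reflect : ∀ y d → rising (- (y + fromℕ d)) d ≡ sign d * rising (1ℚ + y) d
rising-reflect y zero    = sym (cong (_* 1ℚ) sign-zero)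
rising-reflect y (suc d) = begin
  (- (y + fromℕ (suc d))) * rising (- (y + fromℕ (suc d)) + 1ℚ) d
    ≡⟨ cong (λ u → (- (y + u)) * rising (- (y + u) + 1ℚ) d) (fromℕ-suc d) ⟩
  (- (y + (1ℚ + fromℕ d))) * rising (- (y + (1ℚ + fromℕ d)) + 1ℚ) d
    ≡⟨ cong (λ u → (- (y + (1ℚ + fromℕ d))) * rising u d) (shift y (fromℕ d)) ⟩
  (- (y + (1ℚ + fromℕ d))) * rising (- (y + fromℕ d)) d
    ≡⟨ cong ((- (y + (1ℚ + fromℕ d))) *_) (rising-reflect y d) ⟩
  (- (y + (1ℚ + fromℕ d))) * (sign d * rising (1ℚ + y) d)
    ≡⟨ regroup y (sign d) (rising (1ℚ + y) d) (fromℕ d) ⟩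
  (- sign d) * (rising (1ℚ + y) d * (1ℚ + y + fromℕ d))
    ≡⟨ cong₂ _*_ (sign-suc d) (rising-suc (1ℚ + y) d) ⟨
  sign (suc d) * rising (1ℚ + y) (suc d)
    ∎
  where
  shift : ∀ y z → - (y + (1ℚ + z)) + 1ℚ ≡ - (y + z)
  shift = Solver.solve-∀ ℚ-ring
  regroup : ∀ y s r z → (- (y + (1ℚ + z))) * (s * r) ≡ (- s) * (r * (1ℚ + y + z))
  regroup = Solver.solve-∀ ℚ-ring

C-! : ∀ k b → ((k ℕ.+ b) C k) ℕ.* (k ! ℕ.* b !) ≡ (k ℕ.+ b) !
C-! k b = begin
  (n C k) ℕ.* (k ! ℕ.* b !)                              ≡⟨ cong (λ d → (n C k) ℕ.* (k ! ℕ.* d !)) (ℕ.m+n∸m≡n k b) ⟨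
  (n C k) ℕ.* (k ! ℕ.* (n ∸ k) !)                        ≡⟨ cong (ℕ._* (k ! ℕ.* (n ∸ k) !)) (nCk≡n!/k![n-k]! k≤n) ⟩
  n ! ℕ./ (k ! ℕ.* (n ∸ k) !) ℕ.* (k ! ℕ.* (n ∸ k) !)    ≡⟨ m/n*n≡m (k![n∸k]!∣n! k≤n) ⟩
  n !                                                    ∎
  where
  n = k ℕ.+ b
  k≤n = ℕ.m≤m+n k b
  instance _ = ℕ._!*_!≢0 k (n ∸ k)

mC0≡1 : ∀ m → m C 0 ≡ 1
mC0≡1 m = trans (nCk≡nC[n∸k] {0} {m} z≤n) (nCn≡1 m)

fromℕ-C-! : ∀ k b → fromℕ ((k ℕ.+ b) C k) * (fromℕ (k !) * fromℕ (b !)) ≡ fromℕ ((k ℕ.+ b) !)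
fromℕ-C-! k b = begin
  fromℕ ((k ℕ.+ b) C k) * (fromℕ (k !) * fromℕ (b !))   ≡⟨ cong (fromℕ ((k ℕ.+ b) C k) *_) (fromℕ-* (k !) (b !)) ⟨
  fromℕ ((k ℕ.+ b) C k) * fromℕ (k ! ℕ.* b !)           ≡⟨ fromℕ-* ((k ℕ.+ b) C k) (k ! ℕ.* b !) ⟨
  fromℕ (((k ℕ.+ b) C k) ℕ.* (k ! ℕ.* b !))             ≡⟨ cong fromℕ (C-! k b) ⟩
  fromℕ ((k ℕ.+ b) !)                                   ∎

C*!≡rising : ∀ k b → fromℕ ((k ℕ.+ b) C k) * fromℕ (b !) ≡ rising (1ℚ + fromℕ k) b
C*!≡rising k b = fromℕ-*-cancelˡ (k !) {{k ℕ.!≢0}} (begin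
  fromℕ (k !) * (fromℕ ((k ℕ.+ b) C k) * fromℕ (b !))   ≡⟨ swap (fromℕ (k !)) (fromℕ ((k ℕ.+ b) C k)) (fromℕ (b !)) ⟩
  fromℕ ((k ℕ.+ b) C k) * (fromℕ (k !) * fromℕ (b !))   ≡⟨ fromℕ-C-! k b ⟩
  fromℕ ((k ℕ.+ b) !)                                   ≡⟨ fromℕ-!-+ k b ⟩
  fromℕ (k !) * rising (1ℚ + fromℕ k) b                 ∎)
  where swap : ∀ x y z → x * (y * z) ≡ y * (x * z)
        swap = Solver.solve-∀ ℚ-ring

C*!≡rising′ : ∀ k b → fromℕ ((k ℕ.+ b) C k) * fromℕ (k !) ≡ rising (1ℚ + fromℕ b) k
C*!≡rising′ k b = fromℕ-*-cancelˡ (b !) {{b ℕ.!≢0}} (begin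
  fromℕ (b !) * (fromℕ ((k ℕ.+ b) C k) * fromℕ (k !))   ≡⟨ swap (fromℕ (b !)) (fromℕ ((k ℕ.+ b) C k)) (fromℕ (k !)) ⟩
  fromℕ ((k ℕ.+ b) C k) * (fromℕ (k !) * fromℕ (b !))   ≡⟨ fromℕ-C-! k b ⟩
  fromℕ ((k ℕ.+ b) !)                                   ≡⟨ cong (λ n → fromℕ (n !)) (ℕ.+-comm k b) ⟩
  fromℕ ((b ℕ.+ k) !)                                   ≡⟨ fromℕ-!-+ b k ⟩
  fromℕ (b !) * rising (1ℚ + fromℕ b) k                 ∎)
  where swap : ∀ x y z → x * (y * z) ≡ y * (z * x)
        swap = Solver.solve-∀ ℚ-ring

-- Alternating binomial sums

signedC : ℕ → ℕ → ℚ
signedC m k = sign k * fromℕ (m C k)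

signedC-zero : ∀ m → signedC m 0 ≡ 1ℚ
signedC-zero m = trans (cong₂ _*_ sign-zero (trans (cong fromℕ (mC0≡1 m)) fromℤ-1)) (ℚ.*-identityˡ 1ℚ)

signedC-beyond : ∀ {m k} → m < k → signedC m k ≡ 0ℚ
signedC-beyond {m} {k} m<k =
  trans (cong (λ c → sign k * fromℕ c) (k>n⇒nCk≡0 m<k)) (trans (cong (sign k *_) fromℤ-0) (ℚ.*-zeroʳ (sign k)))

signedC-pascal : ∀ m k → signedC (suc m) (suc k) ≡ signedC m (suc k) - signedC m k
signedC-pascal m k = begin
  sign (suc k) * fromℕ (suc m C suc k)
    ≡⟨ cong (λ c → sign (suc k) * fromℕ c) (nCk+nC[k+1]≡[n+1]C[k+1] m k) ⟨
  sign (suc k) * fromℕ (m C k ℕ.+ m C suc k)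
    ≡⟨ cong₂ _*_ (sign-suc k) (fromℕ-+ (m C k) (m C suc k)) ⟩
  (- sign k) * (fromℕ (m C k) + fromℕ (m C suc k))
    ≡⟨ distrib (sign k) _ _ ⟩
  (- sign k) * fromℕ (m C suc k) - sign k * fromℕ (m C k)
    ≡⟨ cong (λ s → s * fromℕ (m C suc k) - signedC m k) (sign-suc k) ⟨
  signedC m (suc k) - signedC m k
    ∎
  where distrib : ∀ s x y → (- s) * (x + y) ≡ (- s) * y - s * x
        distrib = Solver.solve-∀ ℚ-ring

altSum : ℕ → (ℕ → ℚ) → ℚ
altSum m g = ∑ (suc m) (λ k → signedC m k * g k)

module _ (m : ℕ) where

  altSum-cong : ∀ {f g} → (∀ k → f k ≡ g k) → altSum m f ≡ altSum m g
  altSum-cong f≗g = ∑-cong (λ k → cong (signedC m k *_) (f≗g k))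

  altSum-+ : ∀ f g → altSum m (λ k → f k + g k) ≡ altSum m f + altSum m g
  altSum-+ f g = trans (∑-cong (λ k → ℚ.*-distribˡ-+ (signedC m k) (f k) (g k)))
                       (∑-+ (λ k → signedC m k * f k) (λ k → signedC m k * g k))

  altSum-- : ∀ f g → altSum m (λ k → f k - g k) ≡ altSum m f - altSum m g
  altSum-- f g = trans (∑-cong (λ k → distrib (signedC m k) (f k) (g k)))
                       (∑-- (λ k → signedC m k * f k) (λ k → signedC m k * g k))
    where distrib : ∀ c x y → c * (x - y) ≡ c * x - c * y
          distrib = Solver.solve-∀ ℚ-ring

  altSum-*ˡ : ∀ x f → altSum m (λ k → x * f k) ≡ x * altSum m f
  altSum-*ˡ x f = trans (∑-cong (λ k → swap (signedC m k) x (f k))) (∑-*ˡ x (λ k → signedC m k * f k))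
    where swap : ∀ c x y → c * (x * y) ≡ x * (c * y)
          swap = Solver.solve-∀ ℚ-ring

altSum-suc : ∀ m g → altSum (suc m) g ≡ altSum m g - altSum m (g ∘ suc)
altSum-suc m g = begin
  altSum (suc m) g
    ≡⟨ ∑-suc (suc m) (λ k → signedC (suc m) k * g k) ⟩
  signedC (suc m) 0 * g 0 + ∑ (suc m) (λ k → signedC (suc m) (suc k) * g (suc k))
    ≡⟨ cong₂ _+_ (head (suc m)) (∑-cong pascal) ⟩
  g 0 + ∑ (suc m) (λ k → signedC m (suc k) * g (suc k) - signedC m k * g (suc k))
    ≡⟨ cong (_+_ (g 0)) (∑-- (λ k → signedC m (suc k) * g (suc k)) (λ k → signedC m k * g (suc k))) ⟩
  g 0 + (tail - altSum m (g ∘ suc))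
    ≡⟨ ℚ.+-assoc (g 0) tail (- altSum m (g ∘ suc)) ⟨
  (g 0 + tail) - altSum m (g ∘ suc)
    ≡⟨ cong (_- altSum m (g ∘ suc)) head+tail ⟩
  altSum m g - altSum m (g ∘ suc)
    ∎
  where
  head : ∀ n → signedC n 0 * g 0 ≡ g 0
  head n = trans (cong (_* g 0) (signedC-zero n)) (ℚ.*-identityˡ (g 0))
  pascal : ∀ k → signedC (suc m) (suc k) * g (suc k) ≡ signedC m (suc k) * g (suc k) - signedC m k * g (suc k)
  pascal k = trans (cong (_* g (suc k)) (signedC-pascal m k)) (distrib (signedC m (suc k)) (signedC m k) (g (suc k)))
    where distrib : ∀ x y z → (x - y) * z ≡ x * z - y * z
          distrib = Solver.solve-∀ ℚ-ring
  tail = ∑ (suc m) (λ k → signedC m (suc k) * g (suc k))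
  head+tail : g 0 + tail ≡ altSum m g
  head+tail = begin
    g 0 + tail
      ≡⟨ cong (_+ tail) (head m) ⟨
    signedC m 0 * g 0 + tail
      ≡⟨ ∑-suc (suc m) (λ k → signedC m k * g k) ⟨
    ∑ (suc (suc m)) (λ k → signedC m k * g k)
      ≡⟨ ∑-last (suc m) (λ k → signedC m k * g k) ⟩
    altSum m g + signedC m (suc m) * g (suc m)
      ≡⟨ cong (λ c → altSum m g + c * g (suc m)) (signedC-beyond (ℕ.n<1+n m)) ⟩
    altSum m g + 0ℚ * g (suc m)
      ≡⟨ cong (_+_ (altSum m g)) (ℚ.*-zeroˡ (g (suc m))) ⟩
    altSum m g + 0ℚ
      ≡⟨ ℚ.+-identityʳ (altSum m g) ⟩
    altSum m g
      ∎

altSum-vanishes : ∀ m {g} → DegreeBelow m g → altSum m g ≡ 0ℚ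
altSum-vanishes zero    {g} g≡0 =
  trans (∑-one (λ k → signedC 0 k * g k)) (trans (cong (signedC 0 0 *_) (g≡0 0)) (ℚ.*-zeroʳ (signedC 0 0)))
altSum-vanishes (suc m) {g} g<m = begin
  altSum (suc m) g                          ≡⟨ altSum-suc m g ⟩
  altSum m g - altSum m (g ∘ suc)           ≡⟨ flip (altSum m g) (altSum m (g ∘ suc)) ⟩
  - (altSum m (g ∘ suc) - altSum m g)       ≡⟨ cong -_ (altSum-- m (g ∘ suc) g) ⟨
  - altSum m (Δ g)                          ≡⟨ cong -_ (altSum-vanishes m g<m) ⟩
  - 0ℚ                                      ≡⟨⟩
  0ℚ                                        ∎
  where flip : ∀ x y → x - y ≡ - (y - x)
        flip = Solver.solve-∀ ℚ-ring

altSum-reciprocal : ∀ m b → altSum m (λ k → inv (suc b ℕ.+ k)) * rising (1ℚ + fromℕ b) (suc m) ≡ fromℕ (m !)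
altSum-reciprocal zero b = begin
  altSum 0 (λ k → inv (suc b ℕ.+ k)) * ((1ℚ + fromℕ b) * 1ℚ)
    ≡⟨ cong (_* ((1ℚ + fromℕ b) * 1ℚ)) (∑-one (λ k → signedC 0 k * inv (suc b ℕ.+ k))) ⟩
  signedC 0 0 * inv (suc b ℕ.+ 0) * ((1ℚ + fromℕ b) * 1ℚ)
    ≡⟨ cong (λ c → c * inv (suc b ℕ.+ 0) * ((1ℚ + fromℕ b) * 1ℚ)) (signedC-zero 0) ⟩
  1ℚ * inv (suc b ℕ.+ 0) * ((1ℚ + fromℕ b) * 1ℚ)
    ≡⟨ simplify (inv (suc b ℕ.+ 0)) (1ℚ + fromℕ b) ⟩
  (1ℚ + fromℕ b) * inv (suc b ℕ.+ 0)
    ≡⟨ cong (_* inv (suc b ℕ.+ 0)) (trans (sym (fromℕ-suc b)) (cong fromℕ (sym (ℕ.+-identityʳ (suc b))))) ⟩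
  fromℕ (suc b ℕ.+ 0) * inv (suc b ℕ.+ 0)
    ≡⟨ fromℕ*inv≡1 (suc b ℕ.+ 0) ⟩
  1ℚ
    ≡⟨ fromℤ-1 ⟨
  fromℕ (0 !)
    ∎
  where simplify : ∀ i x → 1ℚ * i * (x * 1ℚ) ≡ x * i
        simplify = Solver.solve-∀ ℚ-ring
altSum-reciprocal (suc m) b = begin
  altSum (suc m) (λ k → inv (suc b ℕ.+ k)) * rising (1ℚ + fromℕ b) (suc (suc m))
    ≡⟨ cong (_* rising (1ℚ + fromℕ b) (suc (suc m))) pascal ⟩
  (R b - R (suc b)) * rising (1ℚ + fromℕ b) (suc (suc m))
    ≡⟨ ℚ.*-distribʳ-+ _ (R b) (- R (suc b)) ⟩
  R b * rising (1ℚ + fromℕ b) (suc (suc m)) + (- R (suc b)) * rising (1ℚ + fromℕ b) (suc (suc m))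
    ≡⟨ cong₂ (λ u v → R b * u + (- R (suc b)) * v) (rising-suc (1ℚ + fromℕ b) (suc m)) peel ⟩
  R b * (rising (1ℚ + fromℕ b) (suc m) * (1ℚ + fromℕ b + fromℕ (suc m)))
    + (- R (suc b)) * ((1ℚ + fromℕ b) * rising (1ℚ + fromℕ (suc b)) (suc m))
    ≡⟨ regroup (R b) (R (suc b)) _ _ _ _ ⟩
  (R b * rising (1ℚ + fromℕ b) (suc m)) * (1ℚ + fromℕ b + fromℕ (suc m))
    - (R (suc b) * rising (1ℚ + fromℕ (suc b)) (suc m)) * (1ℚ + fromℕ b)
    ≡⟨ cong₂ (λ u v → u * (1ℚ + fromℕ b + fromℕ (suc m)) - v * (1ℚ + fromℕ b))
             (altSum-reciprocal m b) (altSum-reciprocal m (suc b)) ⟩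
  fromℕ (m !) * (1ℚ + fromℕ b + fromℕ (suc m)) - fromℕ (m !) * (1ℚ + fromℕ b)
    ≡⟨ factor (fromℕ (m !)) (1ℚ + fromℕ b) (fromℕ (suc m)) ⟩
  fromℕ (suc m) * fromℕ (m !)
    ≡⟨ fromℕ-* (suc m) (m !) ⟨
  fromℕ (suc m !)
    ∎
  where
  R : ℕ → ℚ
  R c = altSum m (λ k → inv (suc c ℕ.+ k))
  pascal : altSum (suc m) (λ k → inv (suc b ℕ.+ k)) ≡ R b - R (suc b)
  pascal = trans (altSum-suc m (λ k → inv (suc b ℕ.+ k))) (cong (_-_ (R b)) shifted)
    where shifted : altSum m (λ k → inv (suc b ℕ.+ suc k)) ≡ R (suc b)
          shifted = altSum-cong m (λ k → inv-cong (ℕ.+-suc (suc b) k))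
  peel : rising (1ℚ + fromℕ b) (suc (suc m)) ≡ (1ℚ + fromℕ b) * rising (1ℚ + fromℕ (suc b)) (suc m)
  peel = cong (λ x → (1ℚ + fromℕ b) * rising x (suc m))
              (trans (ℚ.+-comm (1ℚ + fromℕ b) 1ℚ) (cong (_+_ 1ℚ) (sym (fromℕ-suc b))))
  regroup : ∀ r r′ p u p′ v → r * (p * u) + (- r′) * (v * p′) ≡ (r * p) * u - (r′ * p′) * v
  regroup = Solver.solve-∀ ℚ-ring
  factor : ∀ f x y → f * (x + y) - f * x ≡ y * f
  factor = Solver.solve-∀ ℚ-ring

rising*inv-split : ∀ b y d k →
  rising (y + fromℕ k) (suc d) * inv (suc b ℕ.+ k) ≡
  rising (y + 1ℚ + fromℕ k) d + (y - fromℕ (suc b)) * (rising (y + 1ℚ + fromℕ k) d * inv (suc b ℕ.+ k))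
rising*inv-split b y d k = begin
  (y + fromℕ k) * rising (y + fromℕ k + 1ℚ) d * i
    ≡⟨ cong (λ x → (y + fromℕ k) * rising x d * i) (swap y (fromℕ k) 1ℚ) ⟩
  (y + fromℕ k) * r * i
    ≡⟨ expand y β (fromℕ k) r i ⟩
  r * ((β + fromℕ k) * i) + (y - β) * (r * i)
    ≡⟨ cong (λ u → r * u + (y - β) * (r * i)) [β+k]i≡1 ⟩
  r * 1ℚ + (y - β) * (r * i)
    ≡⟨ cong (_+ (y - β) * (r * i)) (ℚ.*-identityʳ r) ⟩
  r + (y - β) * (r * i)
    ∎
  where
  β = fromℕ (suc b)
  i = inv (suc b ℕ.+ k)
  r = rising (y + 1ℚ + fromℕ k) d
  [β+k]i≡1 : (β + fromℕ k) * i ≡ 1ℚ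
  [β+k]i≡1 = trans (cong (_* i) (sym (fromℕ-+ (suc b) k))) (fromℕ*inv≡1 (suc b ℕ.+ k))
  swap : ∀ x y z → x + y + z ≡ x + z + y
  swap = Solver.solve-∀ ℚ-ring
  expand : ∀ y β x r i → (y + x) * r * i ≡ r * ((β + x) * i) + (y - β) * (r * i)
  expand = Solver.solve-∀ ℚ-ring

-- Dividing rising (y + k) d by k + β leaves the remainder rising (y - β) d.
altSum-rising*inv : ∀ {m d} b y → d ≤ m →
  altSum m (λ k → rising (y + fromℕ k) d * inv (suc b ℕ.+ k)) ≡
  rising (y - fromℕ (suc b)) d * altSum m (λ k → inv (suc b ℕ.+ k))
altSum-rising*inv {m} {zero}  b y _ = altSum-*ˡ m 1ℚ (λ k → inv (suc b ℕ.+ k))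
altSum-rising*inv {m} {suc d} b y d<m = begin
  altSum m (λ k → rising (y + fromℕ k) (suc d) * inv (suc b ℕ.+ k))
    ≡⟨ altSum-cong m (rising*inv-split b y d) ⟩
  altSum m (λ k → r k + (y - β) * (r k * inv (suc b ℕ.+ k)))
    ≡⟨ altSum-+ m r (λ k → (y - β) * (r k * inv (suc b ℕ.+ k))) ⟩
  altSum m r + altSum m (λ k → (y - β) * (r k * inv (suc b ℕ.+ k)))
    ≡⟨ cong₂ _+_ (altSum-vanishes m r<m) (altSum-*ˡ m (y - β) (λ k → r k * inv (suc b ℕ.+ k))) ⟩
  0ℚ + (y - β) * altSum m (λ k → r k * inv (suc b ℕ.+ k))
    ≡⟨ cong (λ s → 0ℚ + (y - β) * s) (altSum-rising*inv b (y + 1ℚ) (ℕ.<⇒≤ d<m)) ⟩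
  0ℚ + (y - β) * (rising (y + 1ℚ - β) d * R)
    ≡⟨ regroup (y - β) (rising (y + 1ℚ - β) d) R ⟩
  (y - β) * rising (y + 1ℚ - β) d * R
    ≡⟨ cong (λ x → (y - β) * rising x d * R) (shift y β) ⟩
  rising (y - β) (suc d) * R
    ∎
  where
  β = fromℕ (suc b)
  R = altSum m (λ k → inv (suc b ℕ.+ k))
  r : ℕ → ℚ
  r k = rising (y + 1ℚ + fromℕ k) d
  r<m : DegreeBelow m r
  r<m = DegreeBelow-≤ d<m (DegreeBelow-rising d (DegreeBelow-affine (y + 1ℚ)))
  regroup : ∀ x s R → 0ℚ + x * (s * R) ≡ x * s * R
  regroup = Solver.solve-∀ ℚ-ring
  shift : ∀ y β → y + 1ℚ - β ≡ y - β + 1ℚ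
  shift = Solver.solve-∀ ℚ-ring

-- Inverting a symmetric matrix from an orthogonal triangular basis

δ : ℕ → ℕ → ℚ
δ zero    zero    = 1ℚ
δ zero    (suc j) = 0ℚ
δ (suc i) zero    = 0ℚ
δ (suc i) (suc j) = δ i j

δ-refl : ∀ i → δ i i ≡ 1ℚ
δ-refl zero    = refl
δ-refl (suc i) = δ-refl i

δ-≢ : ∀ {i j} → i ≢ j → δ i j ≡ 0ℚ
δ-≢ {zero}  {zero}  i≢j = contradiction refl i≢j
δ-≢ {zero}  {suc j} i≢j = refl
δ-≢ {suc i} {zero}  i≢j = refl
δ-≢ {suc i} {suc j} i≢j = δ-≢ (i≢j ∘ cong suc)

δ-sym : ∀ i j → δ i j ≡ δ j i
δ-sym zero    zero    = refl
δ-sym zero    (suc j) = refl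
δ-sym (suc i) zero    = refl
δ-sym (suc i) (suc j) = δ-sym i j

∑-*δ : ∀ {n j} (f : ℕ → ℚ) → j < n → ∑ n (λ l → f l * δ l j) ≡ f j
∑-*δ {suc n} {zero} f _ = begin
  ∑ (suc n) (λ l → f l * δ l 0)
    ≡⟨ ∑-suc n (λ l → f l * δ l 0) ⟩
  f 0 * 1ℚ + ∑ n (λ l → f (suc l) * 0ℚ)
    ≡⟨ cong (_+_ (f 0 * 1ℚ)) (trans (∑-cong (λ l → ℚ.*-zeroʳ (f (suc l)))) (∑-zero n)) ⟩
  f 0 * 1ℚ + 0ℚ
    ≡⟨ ℚ.+-identityʳ (f 0 * 1ℚ) ⟩
  f 0 * 1ℚ
    ≡⟨ ℚ.*-identityʳ (f 0) ⟩
  f 0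
    ∎
∑-*δ {suc n} {suc j} f (s≤s j<n) = begin
  ∑ (suc n) (λ l → f l * δ l (suc j))       ≡⟨ ∑-suc n (λ l → f l * δ l (suc j)) ⟩
  f 0 * 0ℚ + ∑ n (λ l → f (suc l) * δ l j)  ≡⟨ cong₂ _+_ (ℚ.*-zeroʳ (f 0)) (∑-*δ (λ l → f (suc l)) j<n) ⟩
  0ℚ + f (suc j)                           ≡⟨ ℚ.+-identityˡ (f (suc j)) ⟩
  f (suc j)                                ∎

I≡δ : ∀ n (i j : Fin n) → I n i j ≡ δ (toℕ i) (toℕ j)
I≡δ (suc n) Fin.zero    Fin.zero    = refl
I≡δ (suc n) Fin.zero    (Fin.suc j) = refl
I≡δ (suc n) (Fin.suc i) Fin.zero    = refl
I≡δ (suc n) (Fin.suc i) (Fin.suc j) = I≡δ n i j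

module Bordering
  (H : ℕ → ℕ → ℚ) (H-sym : ∀ i k → H i k ≡ H k i)
  (A : ℕ → ℕ → ℚ) (w : ℕ → ℚ)
  (A-triangular : ∀ {m k} → m < k → A m k ≡ 0ℚ)
  (A-orthogonal : ∀ {i m} → i < m → ∑ (suc m) (λ k → H i k * A m k) ≡ 0ℚ)
  (A-normalised : ∀ m → w m * A m m * ∑ (suc m) (λ k → H m k * A m k) ≡ 1ℚ)
  where

  HA : ℕ → ℕ → ℚ
  HA i m = ∑ (suc m) (λ k → H i k * A m k)

  B : ℕ → ℕ → ℕ → ℚ
  B zero    k j = 0ℚ
  B (suc N) k j = B N k j + w N * A N k * A N j

  HB : ℕ → ℕ → ℕ → ℚ
  HB N i j = ∑ N (λ k → H i k * B N k j)

  B-sym : ∀ N k j → B N k j ≡ B N j k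
  B-sym zero    k j = refl
  B-sym (suc N) k j = cong₂ _+_ (B-sym N k j) (swap (w N) (A N k) (A N j))
    where swap : ∀ x y z → x * y * z ≡ x * z * y
          swap = Solver.solve-∀ ℚ-ring

  B-outside : ∀ {N k} j → N ≤ k → B N k j ≡ 0ℚ
  B-outside {zero}      j _   = refl
  B-outside {suc N} {k} j N<k = begin
    B N k j + w N * A N k * A N j
      ≡⟨ cong₂ (λ u v → u + w N * v * A N j) (B-outside j (ℕ.<⇒≤ N<k)) (A-triangular N<k) ⟩
    0ℚ + w N * 0ℚ * A N j
      ≡⟨ vanish (w N) (A N j) ⟩
    0ℚ
      ∎
    where vanish : ∀ x y → 0ℚ + x * 0ℚ * y ≡ 0ℚ
          vanish = Solver.solve-∀ ℚ-ring

  HB-last-column : ∀ N i → HB N i N ≡ 0ℚ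
  HB-last-column N i = begin
    ∑ N (λ k → H i k * B N k N)
      ≡⟨ ∑-cong (λ k → cong (H i k *_) (trans (B-sym N k N) (B-outside {N} k ℕ.≤-refl))) ⟩
    ∑ N (λ k → H i k * 0ℚ)
      ≡⟨ ∑-cong (λ k → ℚ.*-zeroʳ (H i k)) ⟩
    ∑ N (λ _ → 0ℚ)
      ≡⟨ ∑-zero N ⟩
    0ℚ
      ∎

  HB-suc : ∀ N i j → HB (suc N) i j ≡ HB N i j + w N * A N j * HA i N
  HB-suc N i j = begin
    ∑ (suc N) (λ k → H i k * (B N k j + w N * A N k * A N j))
      ≡⟨ ∑-cong (λ k → expand (H i k) (B N k j) (w N) (A N k) (A N j)) ⟩
    ∑ (suc N) (λ k → H i k * B N k j + w N * A N j * (H i k * A N k))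
      ≡⟨ ∑-+ (λ k → H i k * B N k j) (λ k → w N * A N j * (H i k * A N k)) ⟩
    ∑ (suc N) (λ k → H i k * B N k j) + ∑ (suc N) (λ k → w N * A N j * (H i k * A N k))
      ≡⟨ cong₂ _+_ (∑-last N (λ k → H i k * B N k j)) (∑-*ˡ (w N * A N j) (λ k → H i k * A N k)) ⟩
    (HB N i j + H i N * B N N j) + w N * A N j * HA i N
      ≡⟨ cong (λ b → (HB N i j + H i N * b) + w N * A N j * HA i N) (B-outside {N} j ℕ.≤-refl) ⟩
    (HB N i j + H i N * 0ℚ) + w N * A N j * HA i N
      ≡⟨ drop (HB N i j) (H i N) (w N * A N j * HA i N) ⟩
    HB N i j + w N * A N j * HA i N
      ∎
    where
    drop : ∀ s h t → (s + h * 0ℚ) + t ≡ s + t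
    drop = Solver.solve-∀ ℚ-ring
    expand : ∀ h b x y z → h * (b + x * y * z) ≡ h * b + x * z * (h * y)
    expand = Solver.solve-∀ ℚ-ring

  A*H≡-∑H*A : ∀ {N k} → k < N → A N N * H N k ≡ - ∑ N (λ l → H k l * A N l)
  A*H≡-∑H*A {N} {k} k<N = begin
    A N N * H N k                        ≡⟨ trans (ℚ.*-comm (A N N) (H N k)) (cong (_* A N N) (H-sym N k)) ⟩
    H k N * A N N                        ≡⟨ solve-for (∑ N (λ l → H k l * A N l)) (H k N * A N N) HAₖ≡0 ⟩
    - ∑ N (λ l → H k l * A N l)          ∎
    where
    HAₖ≡0 : ∑ N (λ l → H k l * A N l) + H k N * A N N ≡ 0ℚ
    HAₖ≡0 = trans (sym (∑-last N (λ l → H k l * A N l))) (A-orthogonal k<N)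
    solve-for : ∀ x y → x + y ≡ 0ℚ → y ≡ - x
    solve-for x y x+y≡0 = begin
      y                   ≡⟨ rearrange x y ⟩
      (x + y) - x         ≡⟨ cong (_- x) x+y≡0 ⟩
      0ℚ - x              ≡⟨ ℚ.+-identityˡ (- x) ⟩
      - x                 ∎
      where rearrange : ∀ x y → y ≡ (x + y) - x
            rearrange = Solver.solve-∀ ℚ-ring

  HA-B≡A-HB : ∀ N j → ∑ N (λ k → ∑ N (λ l → H k l * A N l) * B N k j) ≡ ∑ N (λ l → A N l * HB N l j)
  HA-B≡A-HB N j = begin
    ∑ N (λ k → ∑ N (λ l → H k l * A N l) * B N k j)
      ≡⟨ ∑-cong (λ k → sym (∑-*ʳ (B N k j) (λ l → H k l * A N l))) ⟩
    ∑ N (λ k → ∑ N (λ l → H k l * A N l * B N k j))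
      ≡⟨ ∑-cong (λ k → ∑-cong (λ l → trans (cong (λ h → h * A N l * B N k j) (H-sym k l))
                                                    (reassoc (H l k) (A N l) (B N k j)))) ⟩
    ∑ N (λ k → ∑ N (λ l → A N l * (H l k * B N k j)))
      ≡⟨ ∑-swap N N (λ k l → A N l * (H l k * B N k j)) ⟩
    ∑ N (λ l → ∑ N (λ k → A N l * (H l k * B N k j)))
      ≡⟨ ∑-cong (λ l → ∑-*ˡ (A N l) (λ k → H l k * B N k j)) ⟩
    ∑ N (λ l → A N l * HB N l j)
      ∎
    where reassoc : ∀ h a b → h * a * b ≡ a * (h * b)
          reassoc = Solver.solve-∀ ℚ-ring

  -- Orthogonality of A N to the rows k < N trades the entries H N k for the first N
  -- columns of H, so that the induction hypothesis applies to row N as well.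
  last-row : ∀ {N j} → j < N → (∀ {l} → l < N → HB N l j ≡ δ l j) → A N N * HB N N j ≡ - A N j
  last-row {N} {j} j<N HB≡δ = begin
    A N N * ∑ N (λ k → H N k * B N k j)
      ≡⟨ ∑-*ˡ (A N N) (λ k → H N k * B N k j) ⟨
    ∑ N (λ k → A N N * (H N k * B N k j))
      ≡⟨ ∑-cong< (λ k<N → trans (sym (ℚ.*-assoc (A N N) _ _)) (cong (_* B N _ j) (A*H≡-∑H*A k<N))) ⟩
    ∑ N (λ k → (- ∑ N (λ l → H k l * A N l)) * B N k j)
      ≡⟨ ∑-cong (λ k → ℚ.neg-distribˡ-* (∑ N (λ l → H k l * A N l)) (B N k j)) ⟨
    ∑ N (λ k → - (∑ N (λ l → H k l * A N l) * B N k j))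
      ≡⟨ ∑-neg (λ k → ∑ N (λ l → H k l * A N l) * B N k j) ⟩
    - ∑ N (λ k → ∑ N (λ l → H k l * A N l) * B N k j)
      ≡⟨ cong -_ (HA-B≡A-HB N j) ⟩
    - ∑ N (λ l → A N l * HB N l j)
      ≡⟨ cong -_ (∑-cong< (λ l<N → cong (A N _ *_) (HB≡δ l<N))) ⟩
    - ∑ N (λ l → A N l * δ l j)
      ≡⟨ cong -_ (∑-*δ (A N) j<N) ⟩
    - A N j
      ∎

  HB≡δ : ∀ N {i j} → i < N → j < N → HB N i j ≡ δ i j
  HB≡δ (suc N) {i} {j} i<1+N j<1+N =
    trans (HB-suc N i j) (bordered (ℕ.m<1+n⇒m<n∨m≡n i<1+N) (ℕ.m<1+n⇒m<n∨m≡n j<1+N))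
    where
    bordered : i < N ⊎ i ≡ N → j < N ⊎ j ≡ N → HB N i j + w N * A N j * HA i N ≡ δ i j
    bordered (inj₁ i<N) (inj₁ j<N) = begin
      HB N i j + w N * A N j * HA i N    ≡⟨ cong₂ (λ u v → u + w N * A N j * v) (HB≡δ N i<N j<N) (A-orthogonal i<N) ⟩
      δ i j + w N * A N j * 0ℚ           ≡⟨ drop (δ i j) (w N * A N j) ⟩
      δ i j                              ∎
      where drop : ∀ x y → x + y * 0ℚ ≡ x
            drop = Solver.solve-∀ ℚ-ring
    bordered (inj₁ i<N) (inj₂ refl) = begin
      HB N i N + w N * A N N * HA i N
        ≡⟨ cong₂ (λ u v → u + w N * A N N * v) (HB-last-column N i) (A-orthogonal i<N) ⟩
      0ℚ + w N * A N N * 0ℚ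
        ≡⟨ vanish (w N * A N N) ⟩
      0ℚ
        ≡⟨ δ-≢ (ℕ.<⇒≢ i<N) ⟨
      δ i N
        ∎
      where vanish : ∀ x → 0ℚ + x * 0ℚ ≡ 0ℚ
            vanish = Solver.solve-∀ ℚ-ring
    bordered (inj₂ refl) (inj₂ refl) = begin
      HB N N N + w N * A N N * HA N N    ≡⟨ cong₂ _+_ (HB-last-column N N) (A-normalised N) ⟩
      0ℚ + 1ℚ                            ≡⟨ δ-refl N ⟨
      δ N N                              ∎
    bordered (inj₂ refl) (inj₁ j<N) = begin
      HB N N j + w N * A N j * HA N N    ≡⟨ cancel (HB N N j) (w N) (A N N) (A N j) (HA N N)
                                                   (A-normalised N) (last-row j<N (λ l<N → HB≡δ N l<N j<N)) ⟩
      0ℚ                                 ≡⟨ δ-≢ (ℕ.>⇒≢ j<N) ⟨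
      δ N j                              ∎
      where
      cancel : ∀ s x a y h → x * a * h ≡ 1ℚ → a * s ≡ - y → s + x * y * h ≡ 0ℚ
      cancel s x a y h xah≡1 as≡-y = begin
        s + x * y * h                            ≡⟨ expand s x a y h ⟩
        s * (1ℚ - x * a * h) + x * h * (a * s + y)  ≡⟨ cong₂ (λ u v → s * (1ℚ - u) + x * h * (v + y)) xah≡1 as≡-y ⟩
        s * (1ℚ - 1ℚ) + x * h * (- y + y)        ≡⟨ vanish s (x * h) y ⟩
        0ℚ                                       ∎
        where
        expand : ∀ s x a y h → s + x * y * h ≡ s * (1ℚ - x * a * h) + x * h * (a * s + y)
        expand = Solver.solve-∀ ℚ-ring
        vanish : ∀ s z y → s * (1ℚ - 1ℚ) + z * (- y + y) ≡ 0ℚ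
        vanish = Solver.solve-∀ ℚ-ring

  BH≡δ : ∀ N {i j} → i < N → j < N → ∑ N (λ k → B N i k * H k j) ≡ δ i j
  BH≡δ N {i} {j} i<N j<N = begin
    ∑ N (λ k → B N i k * H k j)
      ≡⟨ ∑-cong (λ k → trans (ℚ.*-comm (B N i k) (H k j)) (cong₂ _*_ (H-sym k j) (B-sym N i k))) ⟩
    ∑ N (λ k → H j k * B N k i)
      ≡⟨ HB≡δ N j<N i<N ⟩
    δ j i
      ≡⟨ δ-sym j i ⟩
    δ i j
      ∎


-- The matrix (1 / (α C(α + i + j, α)))

module HilbertLike (a : ℕ) where

  α : ℕ
  α = suc a

  c : ℕ → ℚ
  c s = inv (α ℕ.* ((α ℕ.+ s) C α)) {{ℕ.m*n≢0 α _ {{_}} {{binom-nz α s}}}}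

  c*rising : ∀ s → c s * rising (1ℚ + fromℕ s) α ≡ fromℕ (a !)
  c*rising s = begin
    c s * rising (1ℚ + fromℕ s) α
      ≡⟨ cong (c s *_) (C*!≡rising′ α s) ⟨
    c s * (fromℕ C′ * fromℕ (α !))
      ≡⟨ cong (λ x → c s * (fromℕ C′ * x)) (fromℕ-* α (a !)) ⟩
    c s * (fromℕ C′ * (fromℕ α * fromℕ (a !)))
      ≡⟨ regroup (c s) (fromℕ C′) (fromℕ α) (fromℕ (a !)) ⟩
    (fromℕ α * fromℕ C′) * c s * fromℕ (a !)
      ≡⟨ cong (λ x → x * c s * fromℕ (a !)) (fromℕ-* α C′) ⟨
    fromℕ (α ℕ.* C′) * c s * fromℕ (a !)
      ≡⟨ cong (_* fromℕ (a !)) (fromℕ*inv≡1 (α ℕ.* C′) {{ℕ.m*n≢0 α _ {{_}} {{binom-nz α s}}}}) ⟩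
    1ℚ * fromℕ (a !)
      ≡⟨ ℚ.*-identityˡ (fromℕ (a !)) ⟩
    fromℕ (a !)
      ∎
    where
    C′ = (α ℕ.+ s) C α
    regroup : ∀ x d u v → x * (d * (u * v)) ≡ (u * d) * x * v
    regroup = Solver.solve-∀ ℚ-ring

  H : ℕ → ℕ → ℚ
  H i k = c (i ℕ.+ k)

  H-sym : ∀ i k → H i k ≡ H k i
  H-sym i k = cong c (ℕ.+-comm i k)

  Aℤ : ℕ → ℕ → ℤ
  Aℤ m k = -1ℤ ℤ.^ k ℤ.* + ((m C k) ℕ.* ((k ℕ.+ (m ℕ.+ a)) C k))

  A : ℕ → ℕ → ℚ
  A m k = fromℤ (Aℤ m k)

  A≡signedC*C : ∀ m k → A m k ≡ signedC m k * fromℕ ((k ℕ.+ (m ℕ.+ a)) C k)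
  A≡signedC*C m k = begin
    fromℤ (-1ℤ ℤ.^ k ℤ.* + ((m C k) ℕ.* D))     ≡⟨ fromℤ-* (-1ℤ ℤ.^ k) (+ ((m C k) ℕ.* D)) ⟩
    sign k * fromℕ ((m C k) ℕ.* D)              ≡⟨ cong (sign k *_) (fromℕ-* (m C k) D) ⟩
    sign k * (fromℕ (m C k) * fromℕ D)          ≡⟨ ℚ.*-assoc (sign k) (fromℕ (m C k)) (fromℕ D) ⟨
    signedC m k * fromℕ D                       ∎
    where D = (k ℕ.+ (m ℕ.+ a)) C k

  A-triangular : ∀ {m k} → m < k → A m k ≡ 0ℚ
  A-triangular {m} {k} m<k = begin
    A m k                                          ≡⟨ A≡signedC*C m k ⟩
    signedC m k * fromℕ ((k ℕ.+ (m ℕ.+ a)) C k)    ≡⟨ cong (_* fromℕ ((k ℕ.+ (m ℕ.+ a)) C k)) (signedC-beyond m<k) ⟩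
    0ℚ * fromℕ ((k ℕ.+ (m ℕ.+ a)) C k)             ≡⟨ ℚ.*-zeroˡ (fromℕ ((k ℕ.+ (m ℕ.+ a)) C k)) ⟩
    0ℚ                                             ∎

  C*c : ℕ → ℕ → ℕ → ℚ
  C*c i m k = fromℕ ((k ℕ.+ (m ℕ.+ a)) C k) * c (i ℕ.+ k)

  HA≡altSum : ∀ i m → ∑ (suc m) (λ k → H i k * A m k) ≡ altSum m (C*c i m)
  HA≡altSum i m = ∑-cong (λ k → trans (cong (H i k *_) (A≡signedC*C m k)) (swap (H i k) (signedC m k) _))
    where swap : ∀ h s d → h * (s * d) ≡ s * (d * h)
          swap = Solver.solve-∀ ℚ-ring

  !*altSum-C*c : ∀ i m → fromℕ ((m ℕ.+ a) !) * altSum m (C*c i m) ≡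
                         altSum m (λ k → rising (1ℚ + fromℕ k) (m ℕ.+ a) * c (i ℕ.+ k))
  !*altSum-C*c i m = trans (sym (altSum-*ˡ m (fromℕ (b !)) (C*c i m))) (altSum-cong m scaled)
    where
    b = m ℕ.+ a
    scaled : ∀ k → fromℕ (b !) * C*c i m k ≡ rising (1ℚ + fromℕ k) b * c (i ℕ.+ k)
    scaled k = trans (sym (ℚ.*-assoc (fromℕ (b !)) (fromℕ ((k ℕ.+ b) C k)) (c (i ℕ.+ k))))
                     (cong (_* c (i ℕ.+ k)) (trans (ℚ.*-comm (fromℕ (b !)) (fromℕ ((k ℕ.+ b) C k))) (C*!≡rising k b)))

  rising*c-off-diagonal : ∀ i e k →
    rising (1ℚ + fromℕ k) (suc (i ℕ.+ e) ℕ.+ a) * c (i ℕ.+ k) ≡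
    fromℕ (a !) * (rising (1ℚ + fromℕ k) i * rising (1ℚ + fromℕ i + fromℕ α + fromℕ k) e)
  rising*c-off-diagonal i e k = begin
    rising x (suc (i ℕ.+ e) ℕ.+ a) * c s
      ≡⟨ cong (λ n → rising x n * c s) b≡ ⟩
    rising x (i ℕ.+ (α ℕ.+ e)) * c s
      ≡⟨ cong (_* c s) (trans (rising-+ x i (α ℕ.+ e)) (cong (rising x i *_) (rising-+ (x + fromℕ i) α e))) ⟩
    rising x i * (rising (x + fromℕ i) α * rising (x + fromℕ i + fromℕ α) e) * c s
      ≡⟨ cong₂ (λ u v → rising x i * (rising u α * rising v e) * c s) x+i≡ x+i+α≡ ⟩
    rising x i * (rising (1ℚ + fromℕ s) α * rising y e) * c s
      ≡⟨ regroup (rising x i) (rising (1ℚ + fromℕ s) α) (rising y e) (c s) ⟩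
    c s * rising (1ℚ + fromℕ s) α * (rising x i * rising y e)
      ≡⟨ cong (_* (rising x i * rising y e)) (c*rising s) ⟩
    fromℕ (a !) * (rising x i * rising y e)
      ∎
    where
    s = i ℕ.+ k
    x = 1ℚ + fromℕ k
    y = 1ℚ + fromℕ i + fromℕ α + fromℕ k
    b≡ : suc (i ℕ.+ e) ℕ.+ a ≡ i ℕ.+ (α ℕ.+ e)
    b≡ = trans (cong suc (trans (ℕ.+-assoc i e a) (cong (i ℕ.+_) (ℕ.+-comm e a)))) (sym (ℕ.+-suc i (a ℕ.+ e)))
    x+i≡ : x + fromℕ i ≡ 1ℚ + fromℕ s
    x+i≡ = trans (shuffle 1ℚ (fromℕ k) (fromℕ i)) (cong (_+_ 1ℚ) (sym (fromℕ-+ i k)))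
      where shuffle : ∀ u v w → u + v + w ≡ u + (w + v)
            shuffle = Solver.solve-∀ ℚ-ring
    x+i+α≡ : x + fromℕ i + fromℕ α ≡ y
    x+i+α≡ = shuffle 1ℚ (fromℕ k) (fromℕ i) (fromℕ α)
      where shuffle : ∀ u v w z → u + v + w + z ≡ u + w + z + v
            shuffle = Solver.solve-∀ ℚ-ring
    regroup : ∀ r s t u → r * (s * t) * u ≡ u * s * (r * t)
    regroup = Solver.solve-∀ ℚ-ring

  A-orthogonal : ∀ {i m} → i < m → ∑ (suc m) (λ k → H i k * A m k) ≡ 0ℚ
  A-orthogonal {i} i<m with ℕ.m≤n⇒∃[o]m+o≡n i<m
  ... | e , refl = trans (HA≡altSum i m) (fromℕ-*-cancelˡ (b !) {{b ℕ.!≢0}} (begin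
    fromℕ (b !) * altSum m (C*c i m)                   ≡⟨ !*altSum-C*c i m ⟩
    altSum m (λ k → rising (1ℚ + fromℕ k) b * c (i ℕ.+ k))  ≡⟨ altSum-cong m (rising*c-off-diagonal i e) ⟩
    altSum m (λ k → fromℕ (a !) * p k)                 ≡⟨ altSum-*ˡ m (fromℕ (a !)) p ⟩
    fromℕ (a !) * altSum m p                           ≡⟨ cong (fromℕ (a !) *_) (altSum-vanishes m p<m) ⟩
    fromℕ (a !) * 0ℚ                                   ≡⟨ ℚ.*-zeroʳ (fromℕ (a !)) ⟩
    0ℚ                                                 ≡⟨ ℚ.*-zeroʳ (fromℕ (b !)) ⟨
    fromℕ (b !) * 0ℚ                                   ∎))
    where
    m = suc (i ℕ.+ e)
    b = m ℕ.+ a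
    y = 1ℚ + fromℕ i + fromℕ α
    p : ℕ → ℚ
    p k = rising (1ℚ + fromℕ k) i * rising (y + fromℕ k) e
    p<m : DegreeBelow m p
    p<m = DegreeBelow-* i e {λ k → rising (1ℚ + fromℕ k) i} {λ k → rising (y + fromℕ k) e}
            (DegreeBelow-rising i (DegreeBelow-affine 1ℚ)) (DegreeBelow-rising e (DegreeBelow-affine y))

  rising*c-diagonal : ∀ m k →
    rising (1ℚ + fromℕ k) (m ℕ.+ a) * c (m ℕ.+ k) ≡
    fromℕ (a !) * (rising (1ℚ + fromℕ k) m * inv (suc (m ℕ.+ a) ℕ.+ k))
  rising*c-diagonal m k = begin
    rising x (m ℕ.+ a) * c s                     ≡⟨ cong (_* c s) (rising-+ x m a) ⟩
    rising x m * rising (x + fromℕ m) a * c s    ≡⟨ ℚ.*-assoc (rising x m) (rising (x + fromℕ m) a) (c s) ⟩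
    rising x m * (rising (x + fromℕ m) a * c s)  ≡⟨ cong (rising x m *_) (*fromℕ≡⇒≡*inv (suc b ℕ.+ k) tail) ⟩
    rising x m * (fromℕ (a !) * inv (suc b ℕ.+ k)) ≡⟨ swap (rising x m) (fromℕ (a !)) (inv (suc b ℕ.+ k)) ⟩
    fromℕ (a !) * (rising x m * inv (suc b ℕ.+ k)) ∎
    where
    b = m ℕ.+ a
    s = m ℕ.+ k
    x = 1ℚ + fromℕ k
    swap : ∀ u v w → u * (v * w) ≡ v * (u * w)
    swap = Solver.solve-∀ ℚ-ring
    x+m≡ : x + fromℕ m ≡ 1ℚ + fromℕ s
    x+m≡ = trans (shuffle 1ℚ (fromℕ k) (fromℕ m)) (cong (_+_ 1ℚ) (sym (fromℕ-+ m k)))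
      where shuffle : ∀ u v w → u + v + w ≡ u + (w + v)
            shuffle = Solver.solve-∀ ℚ-ring
    x+m+a≡ : fromℕ (suc b ℕ.+ k) ≡ x + fromℕ m + fromℕ a
    x+m+a≡ = trans (fromℕ-+ (suc b) k) (trans (cong (_+ fromℕ k) (trans (fromℕ-suc b) (cong (_+_ 1ℚ) (fromℕ-+ m a))))
                                              (shuffle 1ℚ (fromℕ k) (fromℕ m) (fromℕ a)))
      where shuffle : ∀ u v w z → u + (w + z) + v ≡ u + v + w + z
            shuffle = Solver.solve-∀ ℚ-ring
    tail : rising (x + fromℕ m) a * c s * fromℕ (suc b ℕ.+ k) ≡ fromℕ (a !)
    tail = begin
      rising (x + fromℕ m) a * c s * fromℕ (suc b ℕ.+ k)
        ≡⟨ cong (rising (x + fromℕ m) a * c s *_) x+m+a≡ ⟩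
      rising (x + fromℕ m) a * c s * (x + fromℕ m + fromℕ a)
        ≡⟨ swap′ (rising (x + fromℕ m) a) (c s) (x + fromℕ m + fromℕ a) ⟩
      c s * (rising (x + fromℕ m) a * (x + fromℕ m + fromℕ a))
        ≡⟨ cong (c s *_) (rising-suc (x + fromℕ m) a) ⟨
      c s * rising (x + fromℕ m) α
        ≡⟨ cong (λ u → c s * rising u α) x+m≡ ⟩
      c s * rising (1ℚ + fromℕ s) α
        ≡⟨ c*rising s ⟩
      fromℕ (a !)
        ∎
      where swap′ : ∀ r c u → r * c * u ≡ c * (r * u)
            swap′ = Solver.solve-∀ ℚ-ring

  altSum-C*c-diagonal : ∀ m → altSum m (C*c m m) ≡ sign m * altSum m (λ k → inv (suc (m ℕ.+ a) ℕ.+ k))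
  altSum-C*c-diagonal m = fromℕ-*-cancelˡ (b !) {{b ℕ.!≢0}} (begin
    fromℕ (b !) * altSum m (C*c m m)
      ≡⟨ !*altSum-C*c m m ⟩
    altSum m (λ k → rising (1ℚ + fromℕ k) b * c (m ℕ.+ k))
      ≡⟨ altSum-cong m (rising*c-diagonal m) ⟩
    altSum m (λ k → fromℕ (a !) * (rising (1ℚ + fromℕ k) m * inv (suc b ℕ.+ k)))
      ≡⟨ altSum-*ˡ m (fromℕ (a !)) (λ k → rising (1ℚ + fromℕ k) m * inv (suc b ℕ.+ k)) ⟩
    fromℕ (a !) * altSum m (λ k → rising (1ℚ + fromℕ k) m * inv (suc b ℕ.+ k))
      ≡⟨ cong (fromℕ (a !) *_) (altSum-rising*inv b 1ℚ ℕ.≤-refl) ⟩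
    fromℕ (a !) * (rising (1ℚ - fromℕ (suc b)) m * R)
      ≡⟨ cong (λ x → fromℕ (a !) * (rising x m * R)) 1-[1+b]≡ ⟩
    fromℕ (a !) * (rising (- (fromℕ a + fromℕ m)) m * R)
      ≡⟨ cong (λ x → fromℕ (a !) * (x * R)) (rising-reflect (fromℕ a) m) ⟩
    fromℕ (a !) * (sign m * rising (1ℚ + fromℕ a) m * R)
      ≡⟨ regroup (fromℕ (a !)) (sign m) (rising (1ℚ + fromℕ a) m) R ⟩
    fromℕ (a !) * rising (1ℚ + fromℕ a) m * (sign m * R)
      ≡⟨ cong (_* (sign m * R)) (fromℕ-!-+ a m) ⟨
    fromℕ ((a ℕ.+ m) !) * (sign m * R)
      ≡⟨ cong (λ n → fromℕ (n !) * (sign m * R)) (ℕ.+-comm a m) ⟩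
    fromℕ (b !) * (sign m * R)
      ∎)
    where
    b = m ℕ.+ a
    R = altSum m (λ k → inv (suc b ℕ.+ k))
    regroup : ∀ f s r R → f * (s * r * R) ≡ f * r * (s * R)
    regroup = Solver.solve-∀ ℚ-ring
    1-[1+b]≡ : 1ℚ - fromℕ (suc b) ≡ - (fromℕ a + fromℕ m)
    1-[1+b]≡ = trans (cong (_-_ 1ℚ) (trans (fromℕ-suc b) (cong (_+_ 1ℚ) (fromℕ-+ m a))))
                     (simplify (fromℕ m) (fromℕ a))
      where simplify : ∀ u v → 1ℚ - (1ℚ + (u + v)) ≡ - (v + u)
            simplify = Solver.solve-∀ ℚ-ring

  weight : ℕ → ℕ
  weight m = suc (m ℕ.+ a ℕ.+ m)

  w : ℕ → ℚ
  w m = fromℕ (weight m)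

  A-normalised : ∀ m → w m * A m m * ∑ (suc m) (λ k → H m k * A m k) ≡ 1ℚ
  A-normalised m = fromℕ-*-cancelˡ (m !) {{m ℕ.!≢0}} (begin
    fromℕ (m !) * (w m * A m m * ∑ (suc m) (λ k → H m k * A m k))
      ≡⟨ cong₂ (λ u v → fromℕ (m !) * (w m * u * v))
               (A≡signedC*C m m) (trans (HA≡altSum m m) (altSum-C*c-diagonal m)) ⟩
    fromℕ (m !) * (w m * (sign m * fromℕ (m C m) * D) * (sign m * R))
      ≡⟨ regroup (fromℕ (m !)) (w m) (sign m) (fromℕ (m C m)) D R ⟩
    sign m * sign m * fromℕ (m C m) * (D * fromℕ (m !) * w m * R)
      ≡⟨ cong₂ (λ s t → s * t * (D * fromℕ (m !) * w m * R)) (sign-square m) (trans (cong fromℕ (nCn≡1 m)) fromℤ-1) ⟩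
    1ℚ * 1ℚ * (D * fromℕ (m !) * w m * R)
      ≡⟨ ℚ.*-identityˡ (D * fromℕ (m !) * w m * R) ⟩
    D * fromℕ (m !) * w m * R
      ≡⟨ cong₂ (λ u v → u * v * R) (C*!≡rising′ m b) w≡ ⟩
    rising (1ℚ + fromℕ b) m * (1ℚ + fromℕ b + fromℕ m) * R
      ≡⟨ cong (_* R) (rising-suc (1ℚ + fromℕ b) m) ⟨
    rising (1ℚ + fromℕ b) (suc m) * R
      ≡⟨ ℚ.*-comm (rising (1ℚ + fromℕ b) (suc m)) R ⟩
    R * rising (1ℚ + fromℕ b) (suc m)
      ≡⟨ altSum-reciprocal m b ⟩
    fromℕ (m !)
      ≡⟨ ℚ.*-identityʳ (fromℕ (m !)) ⟨
    fromℕ (m !) * 1ℚ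
      ∎)
    where
    b = m ℕ.+ a
    D = fromℕ ((m ℕ.+ b) C m)
    R = altSum m (λ k → inv (suc b ℕ.+ k))
    regroup : ∀ f w s c d R → f * (w * (s * c * d) * (s * R)) ≡ s * s * c * (d * f * w * R)
    regroup = Solver.solve-∀ ℚ-ring
    w≡ : w m ≡ 1ℚ + fromℕ b + fromℕ m
    w≡ = trans (fromℕ-suc (b ℕ.+ m)) (trans (cong (_+_ 1ℚ) (fromℕ-+ b m)) (sym (ℚ.+-assoc 1ℚ (fromℕ b) (fromℕ m))))

  open Bordering H H-sym A w A-triangular A-orthogonal A-normalised public

  Bℤ : ℕ → ℕ → ℕ → ℤ
  Bℤ zero    k j = + 0
  Bℤ (suc N) k j = Bℤ N k j ℤ.+ + weight N ℤ.* Aℤ N k ℤ.* Aℤ N j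

  fromℤ-Bℤ : ∀ N k j → fromℤ (Bℤ N k j) ≡ B N k j
  fromℤ-Bℤ zero    k j = fromℤ-0
  fromℤ-Bℤ (suc N) k j = begin
    fromℤ (Bℤ N k j ℤ.+ + weight N ℤ.* Aℤ N k ℤ.* Aℤ N j)
      ≡⟨ fromℤ-+ (Bℤ N k j) _ ⟩
    fromℤ (Bℤ N k j) + fromℤ (+ weight N ℤ.* Aℤ N k ℤ.* Aℤ N j)
      ≡⟨ cong₂ _+_ (fromℤ-Bℤ N k j) (fromℤ-* (+ weight N ℤ.* Aℤ N k) (Aℤ N j)) ⟩
    B N k j + fromℤ (+ weight N ℤ.* Aℤ N k) * A N j
      ≡⟨ cong (λ x → B N k j + x * A N j) (fromℤ-* (+ weight N) (Aℤ N k)) ⟩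
    B N k j + w N * A N k * A N j
      ∎

theorem4p2 : (α : ℕ) → .{{_ : NonZero α}} → (n : ℕ) →
    Σ (Matrix ℤ (suc n)) (λ B →
      (hilbertLike α n · toℚ B ≐ I (suc n)) × (toℚ B · hilbertLike α n ≐ I (suc n)))
theorem4p2 (suc a) n = inverse , HB≐I , BH≐I
  where
  open HilbertLike a
  inverse : Matrix ℤ (suc n)
  inverse i j = Bℤ (suc n) (toℕ i) (toℕ j)
  entry : ∀ i j → hilbertLike (suc a) n i j ≡ H (toℕ i) (toℕ j)
  entry i j = sym (inv≡1/ _ {{ℕ.m*n≢0 (suc a) _ {{_}} {{binom-nz (suc a) (toℕ i ℕ.+ toℕ j)}}}})
  cast : ∀ i j → toℚ inverse i j ≡ B (suc n) (toℕ i) (toℕ j)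
  cast i j = trans (sym (fromℤ≡/1 (inverse i j))) (fromℤ-Bℤ (suc n) (toℕ i) (toℕ j))
  HB≐I : hilbertLike (suc a) n · toℚ inverse ≐ I (suc n)
  HB≐I i j = begin
    (hilbertLike (suc a) n · toℚ inverse) i j
      ≡⟨ Σℚ≡∑ (suc n) _ (λ k → H (toℕ i) k * B (suc n) k (toℕ j)) (λ k → cong₂ _*_ (entry i k) (cast k j)) ⟩
    HB (suc n) (toℕ i) (toℕ j)
      ≡⟨ HB≡δ (suc n) (toℕ<n i) (toℕ<n j) ⟩
    δ (toℕ i) (toℕ j)
      ≡⟨ I≡δ (suc n) i j ⟨
    I (suc n) i j
      ∎
  BH≐I : toℚ inverse · hilbertLike (suc a) n ≐ I (suc n)
  BH≐I i j = begin
    (toℚ inverse · hilbertLike (suc a) n) i j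
      ≡⟨ Σℚ≡∑ (suc n) _ (λ k → B (suc n) (toℕ i) k * H k (toℕ j)) (λ k → cong₂ _*_ (cast i k) (entry k j)) ⟩
    ∑ (suc n) (λ k → B (suc n) (toℕ i) k * H k (toℕ j))
      ≡⟨ BH≡δ (suc n) (toℕ<n i) (toℕ<n j) ⟩
    δ (toℕ i) (toℕ j)
      ≡⟨ I≡δ (suc n) i j ⟨
    I (suc n) i j
      ∎
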